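{- Let $X$ be a finite set and let $\mathcal{F}\subset 2^X$ be a $k$-cross-free family. Then there exists a weakly-$k$-cross-free family $\mathcal{F}'\subset 2^X$ with $|\mathcal{F}'|\geq |\mathcal{F}|/2$.
   Context: Two sets $A,B\subset X$ are crossing if none of the four sets $A\setminus B$, $B\setminus A$, $A\cap B$, $X\setminus(A\cup B)$ is empty. They are weakly-crossing if none of the three sets $A\cap B$, $A\setminus B$, $B\setminus A$ is empty. A family $\mathcal{F}\subset 2^X$ is $k$-cross-free if it does not contain $k$ pairwise crossing members, and weakly-$k$-cross-free if it does not contain $k$ pairwise weakly-crossing members. -}

module Defs where

open import Data.Nat using (ℕ)
open import Data.Fin using (Fin)
open import Data.Fin.Subset using (Subset; Nonempty; _─_; _∩_; _∪_; ∁)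
open import Data.Product using (Σ; _×_)
open import Data.List using (List)
open import Data.List.Membership.Propositional using (_∈_)
open import Relation.Nullary using (¬_)
open import Relation.Binary.PropositionalEquality using (_≢_)

-- Ground set X = Fin n; subsets of X are  Subset n.

Crossing : {n : ℕ} → Subset n → Subset n → Set
Crossing A B = Nonempty (A ─ B) × Nonempty (B ─ A) × Nonempty (A ∩ B) × Nonempty (∁ (A ∪ B))

WeaklyCrossing : {n : ℕ} → Subset n → Subset n → Set
WeaklyCrossing A B = Nonempty (A ∩ B) × Nonempty (A ─ B) × Nonempty (B ─ A)

-- A family F contains k pairwise R-related members: there are k members
-- g 0, …, g (k-1) of F with g i R g j whenever i ≠ j.
-- (For Crossing / WeaklyCrossing, no set is related to itself, so the
-- g i are automatically pairwise distinct members.)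
HasPairwise : {n : ℕ} → (Subset n → Subset n → Set) → ℕ → List (Subset n) → Set
HasPairwise {n} R k F =
  Σ (Fin k → Subset n) λ g → ((i : Fin k) → g i ∈ F) × ((i j : Fin k) → i ≢ j → R (g i) (g j))

KCrossFree : {n : ℕ} → ℕ → List (Subset n) → Set
KCrossFree k F = ¬ HasPairwise Crossing k F

WeaklyKCrossFree : {n : ℕ} → ℕ → List (Subset n) → Set
WeaklyKCrossFree k F = ¬ HasPairwise WeaklyCrossing k F

-- Fix a point x of the ground set. Among sets avoiding x, weakly crossing already
-- means crossing, since x witnesses that the union is not everything. Complementation
-- preserves crossing and is injective, so the complements of the members containing x
-- also form a weakly-k-cross-free family of sets avoiding x. The two families together
-- have |F| members, so one of them has at least |F|/2.
module Submission where

open import Defs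
open import Data.Nat using (ℕ; zero; suc; _+_; _*_; _≤_)
open import Data.Nat.Properties
  using (≤-total; +-monoʳ-≤; +-identityʳ; +-suc; +-comm; m≤m+n; module ≤-Reasoning)
import Data.Fin as Fin
open Fin using (Fin)
open import Data.Fin.Subset using (Subset; _∈_; _∉_; ∁; _∩_; _∪_; _─_; inside; outside)
open import Data.Fin.Subset.Properties
  using ( _∈?_; x∉p⇒x∈∁p; x∈∁p⇒x∉p; x∈p⇒x∉∁p; x∈p∩q⁺; x∈p∩q⁻; x∈p∪q⁺; x∈p∪q⁻
        ; x∈p∧x∉q⇒x∈p─q; p─q⊆p)
open import Data.Bool.Properties using (not-involutive)
open import Data.Vec using (_∷_; here; there)
open import Data.Vec.Properties using (map-∘; map-cong; map-id)
open import Data.List using (List; []; _∷_; length; map; filter)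
open import Data.List.Properties using (length-map)
open import Data.List.Relation.Unary.Unique.Propositional using (Unique)
open import Data.List.Relation.Unary.Unique.Propositional.Properties using (map⁺; filter⁺)
open import Data.List.Membership.Propositional using () renaming (_∈_ to _∈ₗ_)
open import Data.List.Membership.Propositional.Properties using (∈-filter⁻; ∈-map⁻)
open import Data.Product using (Σ; _×_; _,_; proj₁; proj₂)
open import Data.Sum using (_⊎_; inj₁; inj₂; [_,_])
open import Function using (_∘_)
open import Relation.Nullary using (yes; no)
open import Relation.Unary using (Decidable)
open import Relation.Unary.Properties using (∁?)
open import Relation.Binary.PropositionalEquality
  using (_≡_; refl; sym; trans; cong; subst; module ≡-Reasoning)

variable
  n k : ℕ

∁-involutive : (p : Subset n) → ∁ (∁ p) ≡ p
∁-involutive p = trans (sym (map-∘ _ _ p)) (trans (map-cong not-involutive p) (map-id p))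

∁-injective : {p q : Subset n} → ∁ p ≡ ∁ q → p ≡ q
∁-injective {p = p} {q} eq = trans (sym (∁-involutive p)) (trans (cong ∁ eq) (∁-involutive q))

x∈p─q⇒x∉q : {x : Fin n} (p q : Subset n) → x ∈ p ─ q → x ∉ q
x∈p─q⇒x∉q (inside ∷ p)  (outside ∷ q) here        ()
x∈p─q⇒x∉q (_ ∷ p)       (_ ∷ q)       (there x∈)  (there x∈q) = x∈p─q⇒x∉q p q x∈ x∈q

x∈p─q⇒x∈∁q─∁p : {x : Fin n} (p q : Subset n) → x ∈ p ─ q → x ∈ ∁ q ─ ∁ p
x∈p─q⇒x∈∁q─∁p p q x∈ =
  x∈p∧x∉q⇒x∈p─q (x∉p⇒x∈∁p (x∈p─q⇒x∉q p q x∈)) (x∈p⇒x∉∁p (p─q⊆p p q x∈))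

x∉p∪q⇒x∈∁p∩∁q : {x : Fin n} (p q : Subset n) → x ∉ p ∪ q → x ∈ ∁ p ∩ ∁ q
x∉p∪q⇒x∈∁p∩∁q p q x∉ =
  x∈p∩q⁺ (x∉p⇒x∈∁p (x∉ ∘ x∈p∪q⁺ ∘ inj₁) , x∉p⇒x∈∁p (x∉ ∘ x∈p∪q⁺ ∘ inj₂))

x∈p∩q⇒x∈∁[∁p∪∁q] : {x : Fin n} (p q : Subset n) → x ∈ p ∩ q → x ∈ ∁ (∁ p ∪ ∁ q)
x∈p∩q⇒x∈∁[∁p∪∁q] p q x∈ with x∈p∩q⁻ p q x∈
... | x∈p , x∈q = x∉p⇒x∈∁p ([ x∈p⇒x∉∁p x∈p , x∈p⇒x∉∁p x∈q ] ∘ x∈p∪q⁻ (∁ p) (∁ q))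

Crossing-∁ : {A B : Subset n} → Crossing A B → Crossing (∁ A) (∁ B)
Crossing-∁ {A = A} {B} ((a , a∈) , (b , b∈) , (c , c∈) , (d , d∈)) =
  (b , x∈p─q⇒x∈∁q─∁p B A b∈) ,
  (a , x∈p─q⇒x∈∁q─∁p A B a∈) ,
  (d , x∉p∪q⇒x∈∁p∩∁q A B (x∈∁p⇒x∉p d∈)) ,
  (c , x∈p∩q⇒x∈∁[∁p∪∁q] A B c∈)

WeaklyCrossing⇒Crossing : {x : Fin n} {A B : Subset n} →
  x ∉ A → x ∉ B → WeaklyCrossing A B → Crossing A B
WeaklyCrossing⇒Crossing {x = x} {A} {B} x∉A x∉B (A∩B , A─B , B─A) =
  A─B , B─A , A∩B , x , x∉p⇒x∈∁p ([ x∉A , x∉B ] ∘ x∈p∪q⁻ A B)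

HasPairwise-map : {R S : Subset n → Subset n → Set} {F G : List (Subset n)}
  (f : Subset n → Subset n) →
  (∀ {A} → A ∈ₗ G → f A ∈ₗ F) →
  (∀ {A B} → A ∈ₗ G → B ∈ₗ G → S A B → R (f A) (f B)) →
  HasPairwise S k G → HasPairwise R k F
HasPairwise-map f f∈ f-rel (g , g∈ , g-rel) =
  f ∘ g , f∈ ∘ g∈ , λ i j i≢j → f-rel (g∈ i) (g∈ j) (g-rel i j i≢j)

length-filter+length-filter-∁ : {A : Set} {P : A → Set} (P? : Decidable P) (xs : List A) →
  length (filter P? xs) + length (filter (∁? P?) xs) ≡ length xs
length-filter+length-filter-∁ P? [] = refl
length-filter+length-filter-∁ P? (x ∷ xs) with P? x
... | yes _ = cong suc (length-filter+length-filter-∁ P? xs)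
... | no _  = trans (+-suc _ _) (cong suc (length-filter+length-filter-∁ P? xs))

m≤n⇒n+m≤2*n : {m n : ℕ} → m ≤ n → n + m ≤ 2 * n
m≤n⇒n+m≤2*n {m} {n} m≤n = begin
  n + m       ≤⟨ +-monoʳ-≤ n m≤n ⟩
  n + n       ≡⟨ cong (n +_) (+-identityʳ n) ⟨
  2 * n       ∎
  where open ≤-Reasoning

larger-half : (a b : ℕ) {c : ℕ} → a + b ≡ c → c ≤ 2 * a ⊎ c ≤ 2 * b
larger-half a b refl with ≤-total b a
... | inj₁ b≤a = inj₁ (m≤n⇒n+m≤2*n b≤a)
... | inj₂ a≤b = inj₂ (subst (_≤ 2 * b) (+-comm b a) (m≤n⇒n+m≤2*n a≤b))

avoiding : Fin n → List (Subset n) → List (Subset n)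
avoiding x = filter (∁? (x ∈?_))

complementsContaining : Fin n → List (Subset n) → List (Subset n)
complementsContaining x = map ∁ ∘ filter (x ∈?_)

length-avoiding+complementsContaining : (x : Fin n) (F : List (Subset n)) →
  length (avoiding x F) + length (complementsContaining x F) ≡ length F
length-avoiding+complementsContaining x F = begin
  length (avoiding x F) + length (map ∁ (filter (x ∈?_) F))
    ≡⟨ cong (length (avoiding x F) +_) (length-map ∁ (filter (x ∈?_) F)) ⟩
  length (avoiding x F) + length (filter (x ∈?_) F)
    ≡⟨ +-comm (length (avoiding x F)) _ ⟩
  length (filter (x ∈?_) F) + length (avoiding x F)
    ≡⟨ length-filter+length-filter-∁ (x ∈?_) F ⟩
  length F ∎
  where open ≡-Reasoning

∈-avoiding⁻ : (x : Fin n) (F : List (Subset n)) {A : Subset n} →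
  A ∈ₗ avoiding x F → A ∈ₗ F × x ∉ A
∈-avoiding⁻ x F = ∈-filter⁻ (∁? (x ∈?_)) {xs = F}

∈-complementsContaining⁻ : (x : Fin n) (F : List (Subset n)) {A : Subset n} →
  A ∈ₗ complementsContaining x F → ∁ A ∈ₗ F × x ∉ A
∈-complementsContaining⁻ x F A∈ with ∈-map⁻ ∁ A∈
... | B , B∈ , refl with ∈-filter⁻ (x ∈?_) {xs = F} B∈
... | B∈F , x∈B = subst (_∈ₗ F) (sym (∁-involutive B)) B∈F , x∈p⇒x∉∁p x∈B

avoiding-weaklyKCrossFree : (x : Fin n) {F : List (Subset n)} →
  KCrossFree k F → WeaklyKCrossFree k (avoiding x F)
avoiding-weaklyKCrossFree x {F} kcf =
  kcf ∘ HasPairwise-map {R = Crossing} {S = WeaklyCrossing} (λ A → A)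
  (proj₁ ∘ ∈-avoiding⁻ x F)
  (λ A∈ B∈ → WeaklyCrossing⇒Crossing (proj₂ (∈-avoiding⁻ x F A∈)) (proj₂ (∈-avoiding⁻ x F B∈)))

complementsContaining-weaklyKCrossFree : (x : Fin n) {F : List (Subset n)} →
  KCrossFree k F → WeaklyKCrossFree k (complementsContaining x F)
complementsContaining-weaklyKCrossFree x {F} kcf =
  kcf ∘ HasPairwise-map {R = Crossing} {S = WeaklyCrossing} ∁
  (proj₁ ∘ ∈-complementsContaining⁻ x F)
  (λ A∈ B∈ → Crossing-∁ ∘ WeaklyCrossing⇒Crossing
    (proj₂ (∈-complementsContaining⁻ x F A∈)) (proj₂ (∈-complementsContaining⁻ x F B∈)))

weaklyKCrossFree-Subset0 : {F : List (Subset 0)} → KCrossFree k F → WeaklyKCrossFree k F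
weaklyKCrossFree-Subset0 kcf = kcf ∘ HasPairwise-map {R = Crossing} {S = WeaklyCrossing}
  (λ A → A) (λ A∈ → A∈)
  (λ { _ _ ((() , _) , _) })

lemma2p1 : (n k : ℕ) (F : List (Subset n)) → Unique F → KCrossFree k F →
    Σ (List (Subset n)) λ F' → Unique F' × WeaklyKCrossFree k F' × (length F ≤ 2 * length F')
lemma2p1 zero k F u kcf = F , u , weaklyKCrossFree-Subset0 kcf , m≤m+n (length F) _
lemma2p1 (suc n) k F u kcf
  with larger-half (length (avoiding Fin.zero F)) (length (complementsContaining Fin.zero F))
                   (length-avoiding+complementsContaining Fin.zero F)
... | inj₁ |F|≤2|avoiding| =
  avoiding Fin.zero F , filter⁺ _ u , avoiding-weaklyKCrossFree Fin.zero kcf , |F|≤2|avoiding|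
... | inj₂ |F|≤2|complements| =
  complementsContaining Fin.zero F , map⁺ ∁-injective (filter⁺ _ u) ,
  complementsContaining-weaklyKCrossFree Fin.zero kcf , |F|≤2|complements|
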